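{- For every word $w$ of length $n\ge 1$ over an alphabet $\Sigma$, $SP_{n-1}(w)+SP_n(w)\le 2$.
   Context: A scattered subword of $w$ is a (not necessarily contiguous) subsequence of $w$. A palindrome is a word equal to its reversal. For $t\ge 0$, $SP_t(w)$ is the number of distinct palindromes of length $t$ that are scattered subwords of $w$. -}

module Defs where

open import Data.Nat using (ℕ; zero; suc; _+_; _≤_)
import Data.Nat as ℕ
open import Data.List using (List; []; _∷_; _++_; map; length; reverse; filter; deduplicate)
import Data.List.Properties as LP
open import Data.Product using (_×_)
open import Relation.Binary.Definitions using (DecidableEquality)
open import Relation.Binary.PropositionalEquality using (_≡_)
open import Relation.Nullary.Decidable using (_×-dec_)

scatteredSubwords : {A : Set} → List A → List (List A)
scatteredSubwords [] = [] ∷ []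
scatteredSubwords (x ∷ xs) =
  scatteredSubwords xs ++ map (x ∷_) (scatteredSubwords xs)

IsPalindrome : {A : Set} → List A → Set
IsPalindrome p = p ≡ reverse p

SP : {A : Set} → DecidableEquality A → ℕ → List A → ℕ
SP {A} _≟_ t w =
  length (deduplicate (LP.≡-dec _≟_)
    (filter (λ p → (length p ℕ.≟ t) ×-dec LP.≡-dec _≟_ p (reverse p))
            (scatteredSubwords w)))

{-# OPTIONS --safe #-}
-- Write w = a v b.  A palindrome that is w or w with one letter deleted has either lost a or
-- b, or has the form a u b with u a palindrome obtained in the same way from v.  If a ≠ b only
-- the first option is possible, leaving the two words v b and a v.  If a = b and v is nonempty,
-- the two deletions of an end letter are again of the form a u a (being palindromes, they force
-- v to begin, resp. end, with a), so by induction on v there are at most two such palindromes.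
-- Every palindromic subword of length |w| - 1 or |w| is one of them.
module Submission where

open import Defs
open import Data.Nat using (ℕ; suc; _+_; _≤_; z≤n; s≤s)
import Data.Nat as ℕ
open import Data.Nat.Properties using (≤-refl; ≤-reflexive; ≤-trans; m≤n⇒m≤1+n; ≤-antisym; 1+n≢n)
open import Data.List using (List; []; _∷_; _++_; _∷ʳ_; [_]; length; reverse; filter; deduplicate)
import Data.List.Properties as LP
open import Data.List.Reverse using (Reverse; []; _∶_∶ʳ_; reverseView)
open import Data.List.Membership.Propositional using (_∈_)
open import Data.List.Membership.Propositional.Properties using (∈-filter⁻; ∈-deduplicate⁻; ∈-++⁻; ∈-map⁻)
open import Data.List.Relation.Unary.Any using (here; there)
open import Data.List.Relation.Unary.All using (_∷_)
open import Data.List.Relation.Unary.AllPairs using (_∷_)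
open import Data.List.Relation.Unary.Unique.Propositional using (Unique)
import Data.List.Relation.Unary.Unique.Propositional.Properties as Unique
import Data.List.Relation.Unary.Unique.DecPropositional.Properties as DecUnique
open import Data.List.Relation.Binary.Disjoint.Propositional using (Disjoint)
open import Data.List.Relation.Binary.Pointwise using (Pointwise-≡⇒≡)
open import Data.List.Relation.Binary.Sublist.Propositional using (_⊆_; []; _∷_)
import Data.List.Relation.Binary.Sublist.Propositional as Sublist
open import Data.List.Relation.Binary.Sublist.Heterogeneous.Properties using (length-mono-≤; toPointwise)
open import Data.Product using (_×_; _,_; proj₁; proj₂; ∃; ∃₂)
open import Data.Sum using (_⊎_; inj₁; inj₂)
import Data.Sum as Sum
open import Data.Empty using (⊥; ⊥-elim)
open import Function using (_∘_)
open import Relation.Nullary using (Dec; yes; no; contradiction)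
open import Relation.Nullary.Decidable using (_×-dec_)
open import Relation.Binary.Definitions using (DecidableEquality)
open import Relation.Binary.PropositionalEquality using (_≡_; _≢_; refl; sym; trans; cong; subst)

AtMostTwo : {B : Set} → (B → Set) → Set
AtMostTwo {B} P = ∃₂ λ (c₁ c₂ : B) → ∀ x → P x → x ≡ c₁ ⊎ x ≡ c₂

unique⇒length≤2 : {B : Set} {c₁ c₂ : B} {xs : List B} → Unique xs →
                  (∀ {x} → x ∈ xs → x ≡ c₁ ⊎ x ≡ c₂) → length xs ≤ 2
unique⇒length≤2 {xs = []}        _ _ = z≤n
unique⇒length≤2 {xs = _ ∷ []}     _ _ = s≤s z≤n
unique⇒length≤2 {xs = _ ∷ _ ∷ []} _ _ = s≤s (s≤s z≤n)
unique⇒length≤2 {c₁ = c₁} {c₂} {x ∷ y ∷ z ∷ _} ((x≢y ∷ x≢z ∷ _) ∷ (y≢z ∷ _) ∷ _) classify =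
  ⊥-elim (two-of-three (classify (here refl)) (classify (there (here refl))) (classify (there (there (here refl)))))
  where
  two-of-three : x ≡ c₁ ⊎ x ≡ c₂ → y ≡ c₁ ⊎ y ≡ c₂ → z ≡ c₁ ⊎ z ≡ c₂ → ⊥
  two-of-three (inj₁ refl) (inj₁ refl) _ = x≢y refl
  two-of-three (inj₂ refl) (inj₂ refl) _ = x≢y refl
  two-of-three (inj₁ refl) _ (inj₁ refl) = x≢z refl
  two-of-three (inj₂ refl) _ (inj₂ refl) = x≢z refl
  two-of-three _ (inj₁ refl) (inj₁ refl) = y≢z refl
  two-of-three _ (inj₂ refl) (inj₂ refl) = y≢z refl

module _ {A : Set} where

  ∈-scatteredSubwords⁻ : ∀ w {p : List A} → p ∈ scatteredSubwords w → p ⊆ w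
  ∈-scatteredSubwords⁻ [] (here refl) = []
  ∈-scatteredSubwords⁻ (x ∷ w) p∈ with ∈-++⁻ (scatteredSubwords w) p∈
  ... | inj₁ p∈w = x Sublist.∷ʳ ∈-scatteredSubwords⁻ w p∈w
  ... | inj₂ p∈x∷w with ∈-map⁻ (x ∷_) p∈x∷w
  ... | q , q∈w , refl = refl ∷ ∈-scatteredSubwords⁻ w q∈w

  data AtMostOneDeletion : List A → List A → Set where
    same : ∀ {w} → AtMostOneDeletion w w
    drop : ∀ {x w} → AtMostOneDeletion (x ∷ w) w
    keep : ∀ {x w p} → AtMostOneDeletion w p → AtMostOneDeletion (x ∷ w) (x ∷ p)

  ⊆⇒atMostOneDeletion : ∀ {p w} → p ⊆ w → length w ≤ suc (length p) → AtMostOneDeletion w p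
  ⊆⇒atMostOneDeletion []        _ = same
  ⊆⇒atMostOneDeletion (y Sublist.∷ʳ p⊆w) (s≤s |w|≤|p|)
    with refl ← Pointwise-≡⇒≡ (toPointwise (≤-antisym (length-mono-≤ p⊆w) |w|≤|p|) p⊆w) = drop
  ⊆⇒atMostOneDeletion (refl ∷ p⊆w) (s≤s |w|≤1+|p|) = keep (⊆⇒atMostOneDeletion p⊆w |w|≤1+|p|)

  atMostOneDeletion-last : ∀ s (y : A) → AtMostOneDeletion (s ∷ʳ y) s
  atMostOneDeletion-last []      y = drop
  atMostOneDeletion-last (x ∷ s) y = keep (atMostOneDeletion-last s y)

  atMostOneDeletion-∷ʳ⁻ : ∀ v (b : A) {q} → AtMostOneDeletion (v ∷ʳ b) q →
                          q ≡ v ⊎ ∃ λ u → AtMostOneDeletion v u × q ≡ u ∷ʳ b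
  atMostOneDeletion-∷ʳ⁻ []      b same            = inj₂ ([] , same , refl)
  atMostOneDeletion-∷ʳ⁻ []      b drop            = inj₁ refl
  atMostOneDeletion-∷ʳ⁻ []      b (keep same)     = inj₂ ([] , same , refl)
  atMostOneDeletion-∷ʳ⁻ (x ∷ v) b same            = inj₂ (x ∷ v , same , refl)
  atMostOneDeletion-∷ʳ⁻ (x ∷ v) b drop            = inj₂ (v , drop , refl)
  atMostOneDeletion-∷ʳ⁻ (x ∷ v) b (keep v∷ʳb⇝q) with atMostOneDeletion-∷ʳ⁻ v b v∷ʳb⇝q
  ... | inj₁ refl             = inj₁ refl
  ... | inj₂ (u , v⇝u , refl) = inj₂ (x ∷ u , keep v⇝u , refl)

  atMostOneDeletion-wrap⁻ : ∀ (a : A) v b {p} → AtMostOneDeletion (a ∷ v ∷ʳ b) p →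
    p ≡ v ∷ʳ b ⊎ p ≡ a ∷ v ⊎ ∃ λ u → AtMostOneDeletion v u × p ≡ a ∷ u ∷ʳ b
  atMostOneDeletion-wrap⁻ a v b same = inj₂ (inj₂ (v , same , refl))
  atMostOneDeletion-wrap⁻ a v b drop = inj₁ refl
  atMostOneDeletion-wrap⁻ a v b (keep v∷ʳb⇝q) with atMostOneDeletion-∷ʳ⁻ v b v∷ʳb⇝q
  ... | inj₁ refl             = inj₂ (inj₁ refl)
  ... | inj₂ (u , v⇝u , refl) = inj₂ (inj₂ (u , v⇝u , refl))

  reverse-wrap : ∀ (a : A) u b → reverse (a ∷ u ∷ʳ b) ≡ b ∷ reverse u ∷ʳ a
  reverse-wrap a u b = trans (LP.unfold-reverse a (u ∷ʳ b)) (cong (_∷ʳ a) (LP.reverse-++ u [ b ]))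

  wrap-palindrome⁻ : ∀ (a : A) u b → IsPalindrome (a ∷ u ∷ʳ b) → a ≡ b × IsPalindrome u
  wrap-palindrome⁻ a u b pal with refl , u∷ʳb≡rev-u∷ʳa ← LP.∷-injective (trans pal (reverse-wrap a u b)) =
    refl , proj₁ (LP.∷ʳ-injective u (reverse u) u∷ʳb≡rev-u∷ʳa)

  PalindromicNear : List A → List A → Set
  PalindromicNear w p = AtMostOneDeletion w p × IsPalindrome p

  palindromicNear-unequalEnds : ∀ {a b : A} v {p} → a ≢ b → PalindromicNear (a ∷ v ∷ʳ b) p →
                                p ≡ v ∷ʳ b ⊎ p ≡ a ∷ v
  palindromicNear-unequalEnds {a} {b} v a≢b (w⇝p , pal) with atMostOneDeletion-wrap⁻ a v b w⇝p
  ... | inj₁ p≡v∷ʳb           = inj₁ p≡v∷ʳb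
  ... | inj₂ (inj₁ p≡a∷v)     = inj₂ p≡a∷v
  ... | inj₂ (inj₂ (u , _ , refl)) = contradiction (proj₁ (wrap-palindrome⁻ a u b pal)) a≢b

  palindromicNear-equalEnds : ∀ (a : A) v {p} → v ≢ [] → PalindromicNear (a ∷ v ∷ʳ a) p →
                              ∃ λ u → PalindromicNear v u × p ≡ a ∷ u ∷ʳ a
  palindromicNear-equalEnds a v v≢[] (w⇝p , pal) with atMostOneDeletion-wrap⁻ a v a w⇝p
  ... | inj₂ (inj₂ (u , v⇝u , refl)) = u , (v⇝u , proj₂ (wrap-palindrome⁻ a u a pal)) , refl
  ... | inj₁ refl = first-deleted v v≢[] pal
    where
    first-deleted : ∀ v → v ≢ [] → IsPalindrome (v ∷ʳ a) → ∃ λ u → PalindromicNear v u × v ∷ʳ a ≡ a ∷ u ∷ʳ a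
    first-deleted []      v≢[] _   = contradiction refl v≢[]
    first-deleted (x ∷ t) _    pal with refl , pal-t ← wrap-palindrome⁻ x t a pal = t , (drop , pal-t) , refl
  ... | inj₂ (inj₁ refl) = last-deleted (reverseView v) v≢[] pal
    where
    last-deleted : ∀ {v} → Reverse v → v ≢ [] → IsPalindrome (a ∷ v) → ∃ λ u → PalindromicNear v u × a ∷ v ≡ a ∷ u ∷ʳ a
    last-deleted []               v≢[] _   = contradiction refl v≢[]
    last-deleted (s ∶ _ ∶ʳ y) _    pal with refl , pal-s ← wrap-palindrome⁻ a s y pal =
      s , (atMostOneDeletion-last s a , pal-s) , refl

  data Peel : List A → Set where
    empty  : Peel []
    single : ∀ a → Peel [ a ]
    wrap   : ∀ a {v} → Peel v → ∀ b → Peel (a ∷ v ∷ʳ b)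

  peel-≤ : ∀ k w → length w ≤ k → Peel w
  peel-≤ _       []      _        = empty
  peel-≤ (suc k) (a ∷ w) (s≤s |w|≤k) with reverseView w
  ... | []           = single a
  ... | v ∶ _ ∶ʳ b = wrap a (peel-≤ k v (≤-trans (LP.length-++-≤ˡ v) |w|≤k)) b

  peel : ∀ w → Peel w
  peel w = peel-≤ (length w) w ≤-refl

  module _ (_≟_ : DecidableEquality A) where

    palindromicNear-atMostTwo : ∀ {w} → Peel w → AtMostTwo (PalindromicNear w)
    palindromicNear-atMostTwo empty = [] , [] , λ { _ (same , _) → inj₁ refl }
    palindromicNear-atMostTwo (single a) = [ a ] , [] , λ
      { _ (same , _)      → inj₁ refl
      ; _ (drop , _)      → inj₂ refl
      ; _ (keep same , _) → inj₁ refl }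
    palindromicNear-atMostTwo (wrap a {v} peel-v b) with a ≟ b
    ... | no a≢b = v ∷ʳ b , a ∷ v , λ _ → palindromicNear-unequalEnds v a≢b
    palindromicNear-atMostTwo (wrap a {[]} _ b) | yes refl = a ∷ [ a ] , [ a ] , classify
      where
      classify : ∀ p → PalindromicNear (a ∷ [ a ]) p → p ≡ a ∷ [ a ] ⊎ p ≡ [ a ]
      classify _ (w⇝p , _) with atMostOneDeletion-wrap⁻ a [] a w⇝p
      ... | inj₁ refl                   = inj₂ refl
      ... | inj₂ (inj₁ refl)            = inj₂ refl
      ... | inj₂ (inj₂ (_ , same , refl)) = inj₁ refl
    palindromicNear-atMostTwo (wrap a {x ∷ t} peel-v b) | yes refl
      with c₁ , c₂ , classify ← palindromicNear-atMostTwo peel-v =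
      a ∷ c₁ ∷ʳ a , a ∷ c₂ ∷ʳ a , classify′
      where
      classify′ : ∀ p → PalindromicNear (a ∷ (x ∷ t) ∷ʳ a) p → p ≡ a ∷ c₁ ∷ʳ a ⊎ p ≡ a ∷ c₂ ∷ʳ a
      classify′ p near with u , near-u , refl ← palindromicNear-equalEnds a (x ∷ t) (λ ()) near =
        Sum.map (cong (λ c → a ∷ c ∷ʳ a)) (cong (λ c → a ∷ c ∷ʳ a)) (classify u near-u)

    hasLength×isPalindrome? : ∀ t (p : List A) → Dec (length p ≡ t × IsPalindrome p)
    hasLength×isPalindrome? t p = (length p ℕ.≟ t) ×-dec LP.≡-dec _≟_ p (reverse p)

    palindromicSubwords : ℕ → List A → List (List A)
    palindromicSubwords t w =
      deduplicate (LP.≡-dec _≟_) (filter (hasLength×isPalindrome? t) (scatteredSubwords w))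

    ∈-palindromicSubwords⁻ : ∀ {t w p} → p ∈ palindromicSubwords t w →
                             p ⊆ w × length p ≡ t × IsPalindrome p
    ∈-palindromicSubwords⁻ {t} {w} p∈
      with p∈sw , |p|≡t , pal ← ∈-filter⁻ (hasLength×isPalindrome? t) (∈-deduplicate⁻ (LP.≡-dec _≟_) _ p∈) =
      ∈-scatteredSubwords⁻ w p∈sw , |p|≡t , pal

    palindromicSubwords-unique : ∀ t w → Unique (palindromicSubwords t w)
    palindromicSubwords-unique t w = DecUnique.deduplicate-! (LP.≡-dec _≟_) _

    palindromicSubwords-disjoint : ∀ {t t′} w → t ≢ t′ →
                                   Disjoint (palindromicSubwords t w) (palindromicSubwords t′ w)
    palindromicSubwords-disjoint w t≢t′ (p∈t , p∈t′) =
      t≢t′ (trans (sym (length-of p∈t)) (length-of p∈t′))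
      where
      length-of : ∀ {t p} → p ∈ palindromicSubwords t w → length p ≡ t
      length-of p∈ = proj₁ (proj₂ (∈-palindromicSubwords⁻ {w = w} p∈))

    longPalindromicSubword⇒palindromicNear : ∀ {t w p} → length w ≤ suc t →
      p ∈ palindromicSubwords t w → PalindromicNear w p
    longPalindromicSubword⇒palindromicNear {w = w} |w|≤1+t p∈
      with p⊆w , |p|≡t , pal ← ∈-palindromicSubwords⁻ {w = w} p∈ =
      ⊆⇒atMostOneDeletion p⊆w (subst (λ k → length w ≤ suc k) (sym |p|≡t) |w|≤1+t) , pal

corollary4p12 : {A : Set} (_≟_ : DecidableEquality A) (n : ℕ) (w : List A) →
                length w ≡ suc n →
                SP _≟_ n w + SP _≟_ (suc n) w ≤ 2
corollary4p12 {A} _≟_ n w |w|≡1+n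
  with c₁ , c₂ , classify ← palindromicNear-atMostTwo _≟_ (peel w) =
  subst (_≤ 2) (LP.length-++ (pals n)) (unique⇒length≤2 unique near⇒candidate)
  where
  pals : ℕ → List (List A)
  pals t = palindromicSubwords _≟_ t w

  unique : Unique (pals n ++ pals (suc n))
  unique = Unique.++⁺ (palindromicSubwords-unique _≟_ n w) (palindromicSubwords-unique _≟_ (suc n) w)
                      (palindromicSubwords-disjoint _≟_ w (1+n≢n ∘ sym))

  near⇒candidate : ∀ {p} → p ∈ pals n ++ pals (suc n) → p ≡ c₁ ⊎ p ≡ c₂
  near⇒candidate {p} p∈ with ∈-++⁻ (pals n) p∈
  ... | inj₁ p∈n   = classify p (longPalindromicSubword⇒palindromicNear _≟_ |w|≤1+n p∈n)
    where |w|≤1+n = ≤-reflexive |w|≡1+n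
  ... | inj₂ p∈1+n = classify p (longPalindromicSubword⇒palindromicNear _≟_ |w|≤2+n p∈1+n)
    where |w|≤2+n = m≤n⇒m≤1+n (≤-reflexive |w|≡1+n)
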